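{- Let $q,p$ be prime numbers such that $p$ is congruent modulo $q$ to a primitive root modulo $q$. Let $s$ be an integer with $1\le s\le q-1$ and let $r\ge 1$ be an integer. Then $$\sharp\,\mathrm{GL}^{s}_{q\times r}(\mathbb F_p)\;\ge\;\prod_{0\le i\le r-1}\left(\frac1q\binom{q}{s}\left((p-1)^s-(p-1)^{s-1}\right)(q-i)\right).$$
   Context: $\mathrm{GL}^{s}_{n\times r}(\mathbb F_p)$ denotes the set of full-rank $n\times r$ matrices over the finite field $\mathbb F_p$ having exactly $s$ non-zero entries in each column, and $\sharp$ denotes cardinality. -}

module Defs where

open import Data.Nat as ℕ using (ℕ; zero; suc; _∸_; _^_; _≤_; _<_)
open import Data.Nat.Divisibility using (_∣_)
open import Data.Nat.Coprimality using (Coprime)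
open import Data.Nat.Primality using (Prime; prime⇒nonZero)
open import Data.Nat.Combinatorics using (_C_)
open import Data.Integer as ℤ using (ℤ; +_)
open import Data.Integer.Divisibility as ℤD using ()
open import Data.Rational.Unnormalised as ℚ using (ℚᵘ)
open import Data.Fin using (Fin; toℕ)
open import Data.Vec using (Vec; lookup; count; sum; tabulate; allFin)
open import Data.List using (List; length)
open import Data.List.Relation.Unary.All using (All)
open import Data.List.Relation.Unary.Unique.Propositional using (Unique)
open import Data.Product using (Σ; _×_)
open import Relation.Nullary.Decidable using (¬?)
open import Relation.Binary.PropositionalEquality using (_≡_)

PrimitiveRoot : ℕ → ℕ → Set
PrimitiveRoot q g = Coprime g q × (∀ k → 0 < k → q ∣ (g ^ k ∸ 1) → q ∸ 1 ≤ k)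

CongMod : ℕ → ℕ → ℕ → Set
CongMod q a b = (+ q) ℤD.∣ (+ a ℤ.- + b)

-- n × r matrices over F_p = Z/pZ (entries represented by Fin p), as a vector of rows
Matrix : ℕ → ℕ → ℕ → Set
Matrix n r p = Vec (Vec (Fin p) r) n

entry : ∀ {n r p} → Matrix n r p → Fin n → Fin r → Fin p
entry M i j = lookup (lookup M i) j

ColsIndep : ∀ {n r p} → Matrix n r p → Set
ColsIndep {n} {r} {p} M =
  (c : Vec (Fin p) r) →
  (∀ i → p ∣ sum (tabulate (λ j → toℕ (lookup c j) ℕ.* toℕ (entry M i j)))) →
  ∀ j → toℕ (lookup c j) ≡ 0

RowsIndep : ∀ {n r p} → Matrix n r p → Set
RowsIndep {n} {r} {p} M =
  (c : Vec (Fin p) n) →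
  (∀ j → p ∣ sum (tabulate (λ i → toℕ (lookup c i) ℕ.* toℕ (entry M i j)))) →
  ∀ i → toℕ (lookup c i) ≡ 0

-- full rank: rank = min(n, r)
FullRank : ∀ {n r p} → Matrix n r p → Set
FullRank {n} {r} M = (r ≤ n → ColsIndep M) × (n ≤ r → RowsIndep M)

colWeight : ∀ {n r p} → Matrix n r p → Fin r → ℕ
colWeight {n} M j = count (λ i → ¬? (toℕ (entry M i j) ℕ.≟ 0)) (allFin n)

InGL : (n r p s : ℕ) → Matrix n r p → Set
InGL n r p s M = FullRank M × (∀ j → colWeight M j ≡ s)

CardGE : {A : Set} → (A → Set) → ℚᵘ → Set
CardGE {A} P N = Σ (List A) (λ L → Unique L × All P L × N ℚ.≤ (+ length L) ℚ./ 1)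

prodQ : ℕ → (ℕ → ℚᵘ) → ℚᵘ
prodQ zero    f = ℚ.1ℚᵘ
prodQ (suc r) f = prodQ r f ℚ.* f r

bound : (q p s r : ℕ) → Prime q → ℚᵘ
bound q p s r qp = prodQ r (λ i →
    (((+ (q C s)) ℚ./ q) ℚ.*
     ((+ ((p ∸ 1) ^ s) ℤ.- + ((p ∸ 1) ^ (s ∸ 1))) ℚ./ 1)) ℚ.*
     ((+ q ℤ.- + i) ℚ./ 1))
  where instance _ = prime⇒nonZero qp

module Submission where

open import Defs
open import Data.Empty using (⊥-elim)
open import Data.Nat using (ℕ; zero; suc; _≤_; _∸_)
open import Data.Nat.Primality using (Prime; ¬prime[0]; ¬prime[1])
open import Data.Product using (Σ; _×_)

-- The matrices are built column by column. Given i columns of length q that are independent over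
-- F_p, Gaussian elimination yields a set T of at most i pivot rows: a combination of the columns
-- vanishing on T vanishes everywhere. Hence two columns that depend on the given ones and agree on T
-- are equal. Fix a row j ∉ T and send a column of weight s whose j-th entry is neither 0 nor 1 to
-- itself if it extends the tuple, and otherwise to the column with that entry replaced by 1. This
-- is injective, so at least C(q-1, s-1) (p-1)^(s-1) (p-2) extending columns of weight s are
-- non-zero in row j. Summing over the at least q - i rows off T and counting each extending column
-- once per non-zero entry, i.e. s times, there are at least (1/q) C(q,s) ((p-1)^s - (p-1)^(s-1)) (q-i)
-- extending columns. Multiplying over i < r counts r-tuples, which are full-rank matrices: for
-- r = q, a non-trivial relation among the rows would make x ↦ (M x without one coordinate) inject
-- F_p^q into F_p^(q-1). For r > q the bound vanishes.

module Counting where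

  open import Data.Empty using (⊥-elim)
  open import Data.Fin as Fin using (Fin)
  open import Data.List as List using (List; []; _∷_; _++_; length; filter; map; tabulate; cartesianProductWith)
  open import Data.List.Membership.Propositional using (_∈_)
  open import Data.List.Membership.Propositional.Properties using (∈-∃++; ∈-++⁻; ∈-++⁺ˡ; ∈-++⁺ʳ; ∈-cartesianProductWith⁺)
  import Data.List.Properties as List
  open import Data.List.Relation.Unary.All as All using (All)
  open import Data.List.Relation.Unary.Any using (here; there)
  open import Data.List.Relation.Unary.Unique.Propositional using (Unique; []; _∷_)
  import Data.List.Relation.Unary.Unique.Propositional.Properties as Unique
  open import Data.Nat using (ℕ; zero; suc; _+_; _*_; _^_; _≤_; z≤n; s≤s)
  open import Data.Nat.Properties using (+-suc; +-mono-≤; +-*-semiring)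
  open import Data.Product using (∃; _×_; _,_)
  open import Data.Sum using (inj₁; inj₂)
  open import Data.Vec using (Vec; []; _∷_)
  import Data.Vec.Properties as Vec
  open import Function using (_∘_; id)
  open import Relation.Binary.PropositionalEquality using (_≡_; _≢_; refl; sym; trans; cong; cong₂; subst; module ≡-Reasoning)
  open import Relation.Nullary using (Dec; yes; no; ¬_)
  open import Relation.Unary using (Decidable)

  open import Algebra.Properties.Semiring.Sum +-*-semiring public
    using (sum; sum-cong-≗; ∑-distrib-+; *-distribˡ-sum; sum-syntax)

  indicator : {P : Set} → Dec P → ℕ
  indicator (yes _) = 1
  indicator (no _)  = 0

  module _ {A : Set} {P : A → Set} (P? : Decidable P) where

    count : List A → ℕ
    count xs = length (filter P? xs)

    count-∷ : ∀ x xs → count (x ∷ xs) ≡ indicator (P? x) + count xs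
    count-∷ x xs with P? x
    ... | yes _ = refl
    ... | no _  = refl

    count-++ : ∀ xs ys → count (xs ++ ys) ≡ count xs + count ys
    count-++ xs ys = trans (cong length (List.filter-++ P? xs ys)) (List.length-++ (filter P? xs))

    count-none : (∀ x → ¬ P x) → ∀ xs → count xs ≡ 0
    count-none ¬P xs = cong length (List.filter-none P? (All.universal ¬P xs))

  count-map : ∀ {A B : Set} {P : A → Set} (P? : Decidable P) (f : B → A) xs →
              count P? (map f xs) ≡ count (P? ∘ f) xs
  count-map P? f []       = refl
  count-map P? f (x ∷ xs) = trans (count-∷ P? (f x) (map f xs))
    (trans (cong (indicator (P? (f x)) +_) (count-map P? f xs)) (sym (count-∷ (P? ∘ f) x xs)))

  count-cong : ∀ {A : Set} {P Q : A → Set} (P? : Decidable P) (Q? : Decidable Q) →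
               (∀ x → P x → Q x) → (∀ x → Q x → P x) → ∀ xs → count P? xs ≡ count Q? xs
  count-cong P? Q? P⇒Q Q⇒P [] = refl
  count-cong P? Q? P⇒Q Q⇒P (x ∷ xs) with P? x | Q? x
  ... | yes _  | yes _  = cong suc (count-cong P? Q? P⇒Q Q⇒P xs)
  ... | no _   | no _   = count-cong P? Q? P⇒Q Q⇒P xs
  ... | yes px | no ¬qx = ⊥-elim (¬qx (P⇒Q x px))
  ... | no ¬px | yes qx = ⊥-elim (¬px (Q⇒P x qx))

  count-tabulate : ∀ {A : Set} {P : A → Set} (P? : Decidable P) {k} (g : Fin k → A) →
                   count P? (tabulate g) ≡ ∑[ i < k ] indicator (P? (g i))
  count-tabulate P? {zero}  g = refl
  count-tabulate P? {suc k} g =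
    trans (count-∷ P? (g Fin.zero) _) (cong (indicator (P? (g Fin.zero)) +_) (count-tabulate P? (g ∘ Fin.suc)))

  count-cartesianProductWith :
    ∀ {A B C : Set} {P : C → Set} (P? : Decidable P) (f : A → B → C) {k} (g : Fin k → A) ys →
    count P? (cartesianProductWith f (tabulate g) ys) ≡ ∑[ i < k ] count (P? ∘ f (g i)) ys
  count-cartesianProductWith P? f {zero}  g ys = refl
  count-cartesianProductWith P? f {suc k} g ys = begin
    count P? (map (f (g Fin.zero)) ys ++ cartesianProductWith f (tabulate (g ∘ Fin.suc)) ys)
      ≡⟨ count-++ P? (map (f (g Fin.zero)) ys) _ ⟩
    count P? (map (f (g Fin.zero)) ys) + count P? (cartesianProductWith f (tabulate (g ∘ Fin.suc)) ys)
      ≡⟨ cong₂ _+_ (count-map P? (f (g Fin.zero)) ys) (count-cartesianProductWith P? f (g ∘ Fin.suc) ys) ⟩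
    count (P? ∘ f (g Fin.zero)) ys + ∑[ i < k ] count (P? ∘ f (g (Fin.suc i))) ys ∎
    where open ≡-Reasoning

  length-cartesianProductWith : ∀ {A B C : Set} (f : A → B → C) xs ys →
                                length (cartesianProductWith f xs ys) ≡ length xs * length ys
  length-cartesianProductWith f []       ys = refl
  length-cartesianProductWith f (x ∷ xs) ys =
    trans (List.length-++ (map (f x) ys))
          (cong₂ _+_ (List.length-map (f x) ys) (length-cartesianProductWith f xs ys))

  sum-mono-≤ : ∀ {k} {f g : Fin k → ℕ} → (∀ i → f i ≤ g i) → sum f ≤ sum g
  sum-mono-≤ {zero}  f≤g = z≤n
  sum-mono-≤ {suc k} f≤g = +-mono-≤ (f≤g Fin.zero) (sum-mono-≤ (f≤g ∘ Fin.suc))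

  sum-const : ∀ k c → ∑[ i < k ] c ≡ k * c
  sum-const zero    c = refl
  sum-const (suc k) c = cong (c +_) (sum-const k c)

  private
    remove : ∀ {A : Set} {x : A} {ys} → x ∈ ys →
             ∃ λ ys′ → length ys ≡ suc (length ys′) × (∀ {y} → y ∈ ys → y ≢ x → y ∈ ys′)
    remove {x = x} x∈ys with ∈-∃++ x∈ys
    ... | us , vs , refl = us ++ vs , length-removed , keep
      where
      length-removed : length (us ++ x ∷ vs) ≡ suc (length (us ++ vs))
      length-removed = trans (List.length-++ us) (trans (+-suc (length us) (length vs)) (cong suc (sym (List.length-++ us))))
      keep : ∀ {y} → y ∈ us ++ x ∷ vs → y ≢ x → y ∈ us ++ vs
      keep y∈ y≢x with ∈-++⁻ us y∈
      ... | inj₁ y∈us         = ∈-++⁺ˡ y∈us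
      ... | inj₂ (here refl)  = ⊥-elim (y≢x refl)
      ... | inj₂ (there y∈vs) = ∈-++⁺ʳ us y∈vs

  length-≤-of-injection : ∀ {A B : Set} (f : A → B) {xs : List A} {ys : List B} → Unique xs →
                          (∀ {x y} → x ∈ xs → y ∈ xs → f x ≡ f y → x ≡ y) →
                          (∀ {x} → x ∈ xs → f x ∈ ys) → length xs ≤ length ys
  length-≤-of-injection f {[]}     _          _   _    = z≤n
  length-≤-of-injection f {x ∷ xs} (x∉ ∷ !xs) inj into with remove (into (here refl))
  ... | ys′ , |ys|≡1+|ys′| , keep = subst (suc (length xs) ≤_) (sym |ys|≡1+|ys′|)
    (s≤s (length-≤-of-injection f !xs (λ x∈ y∈ → inj (there x∈) (there y∈))
      (λ y∈ → keep (into (there y∈)) (λ fy≡fx → All.lookup x∉ y∈ (sym (inj (there y∈) (here refl) fy≡fx))))))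

  vectors : {A : Set} → List A → ∀ n → List (Vec A n)
  vectors xs zero    = [] ∷ []
  vectors xs (suc n) = cartesianProductWith _∷_ xs (vectors xs n)

  module _ {A : Set} {xs : List A} where

    ∈-vectors : ∀ {n} (v : Vec A n) → (∀ x → x ∈ xs) → v ∈ vectors xs n
    ∈-vectors []      _    = here refl
    ∈-vectors (x ∷ v) ∈xs = ∈-cartesianProductWith⁺ _∷_ (∈xs x) (∈-vectors v ∈xs)

    vectors-unique : Unique xs → ∀ n → Unique (vectors xs n)
    vectors-unique _   zero    = All.[] ∷ []
    vectors-unique !xs (suc n) =
      Unique.cartesianProductWith⁺ _∷_ (λ e → Vec.∷-injectiveˡ e , Vec.∷-injectiveʳ e) !xs (vectors-unique !xs n)

    length-vectors : ∀ n → length (vectors xs n) ≡ length xs ^ n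
    length-vectors zero    = refl
    length-vectors (suc n) =
      trans (length-cartesianProductWith _∷_ xs (vectors xs n)) (cong (length xs *_) (length-vectors n))

module Weights where

  open Counting
  open import Data.Fin as Fin using (Fin; toℕ)
  open import Data.List using (List; []; _∷_; allFin; length)
  open import Data.List.Relation.Unary.All using (All; []; _∷_)
  open import Data.Empty using (⊥-elim)
  open import Data.List.Membership.Propositional using (_∈_)
  open import Data.List.Membership.Propositional.Properties using (∈-allFin)
  import Data.List.Properties as List
  import Data.List.Relation.Unary.Unique.Propositional.Properties as Unique
  open import Data.List.Relation.Unary.Unique.Propositional using (Unique)
  open import Data.Nat using (ℕ; zero; suc; _+_; _*_; _^_; _≤_; _≟_; _≤?_; z≤n; s≤s)
  open import Data.Nat.Combinatorics using (_C_; nCk+nC[k+1]≡[n+1]C[k+1]; nC1≡n)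
  open import Data.Nat.Properties using (suc-injective; *-zeroʳ; *-comm; +-identityʳ; *-suc; *-identityʳ; *-identityˡ)
  open import Data.Nat.Tactic.RingSolver using (solve-∀)
  open import Data.Product using (_×_; _,_)
  open import Data.Vec using (Vec; []; _∷_; lookup; _[_]≔_)
  open import Function using (_∘_; id)
  open import Relation.Binary.PropositionalEquality using (_≡_; _≢_; refl; sym; trans; cong; cong₂; module ≡-Reasoning)
  open import Relation.Nullary using (¬_)
  open import Relation.Nullary.Decidable using (_×-dec_; ¬?)
  open import Relation.Unary using (Decidable)

  allVectors : ∀ p n → List (Vec (Fin p) n)
  allVectors p = vectors (allFin p)

  module _ {p : ℕ} where

    ∈-allVectors : ∀ {n} (v : Vec (Fin p) n) → v ∈ allVectors p n
    ∈-allVectors v = ∈-vectors v ∈-allFin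

    allVectors-unique : ∀ n → Unique (allVectors p n)
    allVectors-unique = vectors-unique (Unique.allFin⁺ p)

    length-allVectors : ∀ n → length (allVectors p n) ≡ p ^ n
    length-allVectors n = trans (length-vectors n) (cong (_^ n) (List.length-tabulate id))

    count-allVectors-suc : ∀ {n} {P : Vec (Fin p) (suc n) → Set} (P? : Decidable P) →
                           count P? (allVectors p (suc n)) ≡ ∑[ x < p ] count (P? ∘ (x ∷_)) (allVectors p n)
    count-allVectors-suc P? = count-cartesianProductWith P? _∷_ id _

    weight : ∀ {n} → Vec (Fin p) n → ℕ
    weight []               = 0
    weight (Fin.zero  ∷ v) = weight v
    weight (Fin.suc _ ∷ v) = suc (weight v)

    weight≟ : ∀ {n} s → Decidable (λ (v : Vec (Fin p) n) → weight v ≡ s)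
    weight≟ s v = weight v ≟ s

  Large : ∀ {p} → Fin p → Set
  Large x = 2 ≤ toℕ x

  module _ {a : ℕ} where

    count-weight : ∀ n s → count (weight≟ s) (allVectors (suc a) n) ≡ (n C s) * a ^ s
    count-weight zero    zero    = refl
    count-weight zero    (suc s) = refl
    count-weight (suc n) zero    = begin
      count (weight≟ 0) (allVectors (suc a) (suc n))
        ≡⟨ count-allVectors-suc {n = n} (weight≟ 0) ⟩
      count (weight≟ 0) (allVectors (suc a) n) + ∑[ y < a ] count (weight≟ 0 ∘ (Fin.suc y ∷_)) (allVectors (suc a) n)
        ≡⟨ cong₂ _+_ (count-weight n 0) (sum-cong-≗ (λ y → count-none (weight≟ 0 ∘ (Fin.suc y ∷_)) (λ _ ()) (allVectors (suc a) n))) ⟩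
      1 + ∑[ y < a ] 0
        ≡⟨ cong suc (trans (sum-const a 0) (*-zeroʳ a)) ⟩
      1 ∎
      where open ≡-Reasoning
    count-weight (suc n) (suc s) = begin
      count (weight≟ (suc s)) (allVectors (suc a) (suc n))
        ≡⟨ count-allVectors-suc {n = n} (weight≟ (suc s)) ⟩
      count (weight≟ (suc s)) (allVectors (suc a) n) + ∑[ y < a ] count (weight≟ (suc s) ∘ (Fin.suc y ∷_)) (allVectors (suc a) n)
        ≡⟨ cong₂ _+_ (count-weight n (suc s)) (sum-cong-≗ (λ y → count-cong (weight≟ (suc s) ∘ (Fin.suc y ∷_)) (weight≟ s) (λ _ → suc-injective) (λ _ → cong suc) (allVectors (suc a) n))) ⟩
      (n C suc s) * a ^ suc s + ∑[ y < a ] count (weight≟ s) (allVectors (suc a) n)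
        ≡⟨ cong ((n C suc s) * a ^ suc s +_) (trans (sum-const a _) (cong (a *_) (count-weight n s))) ⟩
      (n C suc s) * a ^ suc s + a * ((n C s) * a ^ s)
        ≡⟨ pascal-step (n C suc s) (n C s) a (a ^ s) ⟩
      (n C s + n C suc s) * a ^ suc s
        ≡⟨ cong (_* a ^ suc s) (nCk+nC[k+1]≡[n+1]C[k+1] n s) ⟩
      (suc n C suc s) * a ^ suc s ∎
      where
      open ≡-Reasoning
      pascal-step : ∀ x y z w → x * (z * w) + z * (y * w) ≡ (y + x) * (z * w)
      pascal-step = solve-∀

  module _ {p : ℕ} where

    weight-large? : ∀ {n} s (j : Fin n) → Decidable (λ (v : Vec (Fin p) n) → weight v ≡ s × Large (lookup v j))
    weight-large? s j v = weight≟ s v ×-dec (2 ≤? toℕ (lookup v j))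

    weight-zero⇒¬Large : ∀ {n} (v : Vec (Fin p) n) j → weight v ≡ 0 → ¬ Large (lookup v j)
    weight-zero⇒¬Large (Fin.zero ∷ v) Fin.zero    _ ()
    weight-zero⇒¬Large (Fin.zero ∷ v) (Fin.suc j) w = weight-zero⇒¬Large v j w

  module _ {b : ℕ} where

    private
      a = suc b

    count-weight-large : ∀ m s (j : Fin (suc m)) →
                         count (weight-large? (suc s) j) (allVectors (suc a) (suc m)) ≡ (m C s) * a ^ s * b
    count-weight-large m s Fin.zero = begin
      count (weight-large? (suc s) Fin.zero) (allVectors (suc a) (suc m))
        ≡⟨ count-allVectors-suc {n = m} (weight-large? (suc s) Fin.zero) ⟩
      count (weight-large? (suc s) Fin.zero ∘ (Fin.zero ∷_)) (allVectors (suc a) m) +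
        (count (weight-large? (suc s) Fin.zero ∘ (Fin.suc Fin.zero ∷_)) (allVectors (suc a) m) +
         ∑[ y < b ] count (weight-large? (suc s) Fin.zero ∘ (Fin.suc (Fin.suc y) ∷_)) (allVectors (suc a) m))
        ≡⟨ cong₂ _+_ (count-none (weight-large? (suc s) Fin.zero ∘ (Fin.zero ∷_)) (λ { _ (_ , ()) }) (allVectors (suc a) m))
             (cong₂ _+_ (count-none (weight-large? (suc s) Fin.zero ∘ (Fin.suc Fin.zero ∷_)) (λ { _ (_ , s≤s ()) }) (allVectors (suc a) m))
               (sum-cong-≗ λ y → count-cong (weight-large? (suc s) Fin.zero ∘ (Fin.suc (Fin.suc y) ∷_)) (weight≟ s)
                 (λ _ (w , _) → suc-injective w) (λ _ w → cong suc w , s≤s (s≤s z≤n)) (allVectors (suc a) m))) ⟩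
      ∑[ y < b ] count (weight≟ s) (allVectors (suc a) m)
        ≡⟨ trans (sum-const b _) (cong (b *_) (count-weight m s)) ⟩
      b * ((m C s) * a ^ s)
        ≡⟨ *-comm b _ ⟩
      (m C s) * a ^ s * b ∎
      where open ≡-Reasoning
    count-weight-large (suc m) s (Fin.suc j) = begin
      count (weight-large? (suc s) (Fin.suc j)) (allVectors (suc a) (suc (suc m)))
        ≡⟨ count-allVectors-suc {n = suc m} (weight-large? (suc s) (Fin.suc j)) ⟩
      count (weight-large? (suc s) j) (allVectors (suc a) (suc m)) +
        ∑[ y < a ] count (weight-large? (suc s) (Fin.suc j) ∘ (Fin.suc y ∷_)) (allVectors (suc a) (suc m))
        ≡⟨ cong₂ _+_ (count-weight-large m s j)
             (trans (sum-cong-≗ λ y → count-cong (weight-large? (suc s) (Fin.suc j) ∘ (Fin.suc y ∷_)) (weight-large? s j)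
                      (λ _ (w , l) → suc-injective w , l) (λ _ (w , l) → cong suc w , l) (allVectors (suc a) (suc m)))
                    (sum-const a _)) ⟩
      (m C s) * a ^ s * b + a * count (weight-large? s j) (allVectors (suc a) (suc m))
        ≡⟨ pascal s ⟩
      (suc m C s) * a ^ s * b ∎
      where
      open ≡-Reasoning
      pascal : ∀ s → (m C s) * a ^ s * b + a * count (weight-large? s j) (allVectors (suc a) (suc m)) ≡ (suc m C s) * a ^ s * b
      pascal zero = trans (cong ((m C 0) * a ^ 0 * b +_)
                            (trans (cong (a *_) (count-none (weight-large? 0 j) (λ v (w , l) → weight-zero⇒¬Large v j w l) (allVectors (suc a) (suc m))))
                                   (*-zeroʳ a)))
                          (+-identityʳ _)
      pascal (suc s) = begin
        (m C suc s) * a ^ suc s * b + a * count (weight-large? (suc s) j) (allVectors (suc a) (suc m))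
          ≡⟨ cong (λ c → (m C suc s) * a ^ suc s * b + a * c) (count-weight-large m s j) ⟩
        (m C suc s) * (a * a ^ s) * b + a * ((m C s) * a ^ s * b)
          ≡⟨ pascal-step (m C suc s) (m C s) a (a ^ s) b ⟩
        (m C s + m C suc s) * (a * a ^ s) * b
          ≡⟨ cong (λ c → c * (a * a ^ s) * b) (nCk+nC[k+1]≡[n+1]C[k+1] m s) ⟩
        (suc m C suc s) * a ^ suc s * b ∎
        where
        pascal-step : ∀ x y z w u → x * (z * w) * u + z * (y * w * u) ≡ (y + x) * (z * w) * u
        pascal-step = solve-∀

  [1+n]*nCk≡[1+k]*[1+n]C[1+k] : ∀ n k → suc n * (n C k) ≡ suc k * (suc n C suc k)
  [1+n]*nCk≡[1+k]*[1+n]C[1+k] zero    zero    = refl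
  [1+n]*nCk≡[1+k]*[1+n]C[1+k] zero    (suc k) = sym (*-zeroʳ (suc (suc k)))
  [1+n]*nCk≡[1+k]*[1+n]C[1+k] (suc n) zero    = trans (*-identityʳ (suc (suc n))) (sym (trans (*-identityˡ _) (nC1≡n (suc (suc n)))))
  [1+n]*nCk≡[1+k]*[1+n]C[1+k] (suc n) (suc k) = begin
    suc (suc n) * (suc n C suc k)
      ≡⟨ cong (suc (suc n) *_) (sym (nCk+nC[k+1]≡[n+1]C[k+1] n k)) ⟩
    suc (suc n) * (n C k + n C suc k)
      ≡⟨ distribute (suc n) (n C k) (n C suc k) ⟩
    suc n * (n C k) + suc n * (n C suc k) + (n C k + n C suc k)
      ≡⟨ cong₂ (λ u v → u + v + (n C k + n C suc k)) ([1+n]*nCk≡[1+k]*[1+n]C[1+k] n k) ([1+n]*nCk≡[1+k]*[1+n]C[1+k] n (suc k)) ⟩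
    suc k * (suc n C suc k) + suc (suc k) * (suc n C suc (suc k)) + (n C k + n C suc k)
      ≡⟨ cong (suc k * (suc n C suc k) + suc (suc k) * (suc n C suc (suc k)) +_) (nCk+nC[k+1]≡[n+1]C[k+1] n k) ⟩
    suc k * (suc n C suc k) + suc (suc k) * (suc n C suc (suc k)) + (suc n C suc k)
      ≡⟨ collect k (suc n C suc k) (suc n C suc (suc k)) ⟩
    suc (suc k) * (suc n C suc k + suc n C suc (suc k))
      ≡⟨ cong (suc (suc k) *_) (nCk+nC[k+1]≡[n+1]C[k+1] (suc n) (suc k)) ⟩
    suc (suc k) * (suc (suc n) C suc (suc k)) ∎
    where
    open ≡-Reasoning
    distribute : ∀ x y z → suc x * (y + z) ≡ x * y + x * z + (y + z)
    distribute = solve-∀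
    collect : ∀ k u v → suc k * u + suc (suc k) * v + u ≡ suc (suc k) * (u + v)
    collect = solve-∀

  module _ {p : ℕ} where

    nonzero? : ∀ {n} (j : Fin n) → Decidable (λ (v : Vec (Fin p) n) → toℕ (lookup v j) ≢ 0)
    nonzero? j v = ¬? (toℕ (lookup v j) ≟ 0)

    weight≡∑nonzero : ∀ {n} (v : Vec (Fin p) n) → weight v ≡ ∑[ j < n ] indicator (nonzero? j v)
    weight≡∑nonzero []              = refl
    weight≡∑nonzero (Fin.zero  ∷ v) = weight≡∑nonzero v
    weight≡∑nonzero (Fin.suc _ ∷ v) = cong suc (weight≡∑nonzero v)

    double-counting : ∀ {n s} (vs : List (Vec (Fin p) n)) → All (λ v → weight v ≡ s) vs →
                      s * length vs ≡ ∑[ j < n ] count (nonzero? j) vs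
    double-counting {n} {s} []       []         = trans (*-zeroʳ s) (sym (trans (sum-const n 0) (*-zeroʳ n)))
    double-counting {n} {s} (v ∷ vs) (wv ∷ wvs) = begin
      s * suc (length vs)                                                   ≡⟨ *-suc s (length vs) ⟩
      s + s * length vs                                                     ≡⟨ cong₂ _+_ (trans (sym wv) (weight≡∑nonzero v)) (double-counting vs wvs) ⟩
      (∑[ j < n ] indicator (nonzero? j v)) + (∑[ j < n ] count (nonzero? j) vs) ≡⟨ sym (∑-distrib-+ (λ j → indicator (nonzero? j v)) _) ⟩
      (∑[ j < n ] (indicator (nonzero? j v) + count (nonzero? j) vs))         ≡⟨ sum-cong-≗ (λ j → sym (count-∷ (nonzero? j) v vs)) ⟩
      (∑[ j < n ] count (nonzero? j) (v ∷ vs)) ∎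
      where open ≡-Reasoning

  weight-update : ∀ {p n} (w : Vec (Fin (suc p)) n) j {y} → toℕ (lookup w j) ≢ 0 → weight (w [ j ]≔ Fin.suc y) ≡ weight w
  weight-update (Fin.zero  ∷ w) Fin.zero    nz = ⊥-elim (nz refl)
  weight-update (Fin.suc x ∷ w) Fin.zero    nz = refl
  weight-update (Fin.zero  ∷ w) (Fin.suc j) nz = weight-update w j nz
  weight-update (Fin.suc x ∷ w) (Fin.suc j) nz = cong suc (weight-update w j nz)

module LinearAlgebraModP where

  open Counting
  open Weights
  open import Data.Empty using (⊥-elim)
  open import Data.Fin as Fin using (Fin; toℕ; fromℕ<)
  import Data.Fin.Properties as Fin
  open import Data.Integer as ℤ using (ℤ; +_; 0ℤ; _+_; _-_; _*_; ∣_∣; _⊖_)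
  import Data.Integer.Properties as ℤ
  open import Data.Integer.DivMod using (_/ℕ_; _%ℕ_; n%ℕd<d; a≡a%ℕn+[a/ℕn]*n)
  open import Data.Integer.Divisibility.Signed using (_∣_; _∣?_; divides; ∣ᵤ⇒∣; ∣⇒∣ᵤ; ∣m∣n⇒∣m+n; ∣m∣n⇒∣m-n; ∣n⇒∣m*n; ∣m⇒∣m*n)
  open import Data.Integer.Tactic.RingSolver using (solve-∀)
  open import Data.List using (List; []; _∷_; length)
  open import Data.List.Membership.Propositional using (_∈_)
  open import Data.List.Relation.Unary.All as All using (All)
  open import Data.List.Relation.Unary.All.Properties.Core using (¬All⇒Any¬)
  open import Data.List.Relation.Unary.Any as Any using (here; there)
  open import Data.Nat as ℕ using (ℕ; zero; suc; _≤_; z≤n; s≤s)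
  import Data.Nat.Divisibility as ℕ
  import Data.Nat.Properties as ℕ
  open import Data.Nat.Primality using (Prime; euclidsLemma; prime⇒nonZero)
  open import Data.Product using (∃; _×_; _,_)
  open import Data.Sum using (_⊎_; inj₁; inj₂; [_,_]′)
  open import Data.Vec using (Vec; []; _∷_; lookup)
  import Data.Vec.Properties as Vec
  open import Function using (_∘_)
  open import Relation.Binary.PropositionalEquality using (_≡_; refl; sym; trans; cong; cong₂; subst; module ≡-Reasoning)
  open import Relation.Nullary using (¬_; Dec; yes; no)
  open import Relation.Nullary.Decidable using (¬?; _×-dec_; _→-dec_; decidable-stable; map′)
  open import Relation.Unary using (Decidable)

  module _ {p : ℕ} where

    ∀-vector? : ∀ {n} {P : Vec (Fin p) n → Set} → Decidable P → Dec (∀ v → P v)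
    ∀-vector? {n} P? = map′ (λ all v → All.lookup all (∈-allVectors v)) (λ ∀P → All.universal ∀P _)
                            (All.all? P? (allVectors p n))

    ∃-vector? : ∀ {n} {P : Vec (Fin p) n → Set} → Decidable P → Dec (∃ P)
    ∃-vector? {n} P? = map′ Any.satisfied (λ (v , Pv) → Any.map (λ { refl → Pv }) (∈-allVectors v))
                            (Any.any? P? (allVectors p n))

    ¬∀⇒∃¬-vector : ∀ {n} {P : Vec (Fin p) n → Set} → Decidable P → ¬ (∀ v → P v) → ∃ λ v → ¬ P v
    ¬∀⇒∃¬-vector {n} P? ¬∀P = Any.satisfied (¬All⇒Any¬ P? (allVectors p n) (¬∀P ∘ λ all v → All.lookup all (∈-allVectors v)))

  module ModularArithmetic (p : ℕ) (p-prime : Prime p) where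

    private instance
      p-nonZero : ℕ.NonZero p
      p-nonZero = prime⇒nonZero p-prime

    infix 4 p∣_

    p∣_ : ℤ → Set
    p∣ z = + p ∣ z

    p∣? : Decidable p∣_
    p∣? z = + p ∣? z

    p∣0 : p∣ 0ℤ
    p∣0 = divides 0ℤ refl

    p∣-* : ∀ a b → p∣ (a * b) → p∣ a ⊎ p∣ b
    p∣-* a b p∣ab with euclidsLemma ∣ a ∣ ∣ b ∣ p-prime (subst (p ℕ.∣_) (ℤ.abs-* a b) (∣⇒∣ᵤ p∣ab))
    ... | inj₁ p∣a = inj₁ (∣ᵤ⇒∣ p∣a)
    ... | inj₂ p∣b = inj₂ (∣ᵤ⇒∣ p∣b)

    p∣-*-cancelˡ : ∀ a b → ¬ p∣ a → p∣ (a * b) → p∣ b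
    p∣-*-cancelˡ a b ¬p∣a p∣ab = [ ⊥-elim ∘ ¬p∣a , (λ p∣b → p∣b) ]′ (p∣-* a b p∣ab)

    p∣-sub-cancelˡ : ∀ {a b} → p∣ a → p∣ (a - b) → p∣ b
    p∣-sub-cancelˡ {a} {b} p∣a p∣a-b = subst p∣_ (a-[a-b]≡b a b) (∣m∣n⇒∣m-n p∣a p∣a-b)
      where a-[a-b]≡b : ∀ a b → a - (a - b) ≡ b
            a-[a-b]≡b = solve-∀

    p∣-sub-cancelʳ : ∀ {a b} → p∣ b → p∣ (a - b) → p∣ a
    p∣-sub-cancelʳ {a} {b} p∣b p∣a-b = subst p∣_ (a-b+b≡a a b) (∣m∣n⇒∣m+n p∣a-b p∣b)
      where a-b+b≡a : ∀ a b → a - b + b ≡ a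
            a-b+b≡a = solve-∀

    embed : Fin p → ℤ
    embed x = + toℕ x

    private
      p∣-small : ∀ {d} → p ℕ.∣ d → d ℕ.< p → d ≡ 0
      p∣-small {zero}  _    _   = refl
      p∣-small {suc d} p∣d d<p = ⊥-elim (ℕ.<⇒≱ d<p (ℕ.∣⇒≤ p∣d))

    p∣embed⇒zero : ∀ (x : Fin p) → p∣ embed x → toℕ x ≡ 0
    p∣embed⇒zero x p∣x = p∣-small (∣⇒∣ᵤ p∣x) (Fin.toℕ<n x)

    p∣embed-sub⇒≡ : ∀ (x y : Fin p) → p∣ (embed x - embed y) → x ≡ y
    p∣embed-sub⇒≡ x y p∣x-y =
      Fin.toℕ-injective (ℤ.+-injective (ℤ.i-j≡0⇒i≡j _ _ (trans x-y≡x⊖y (ℤ.∣i∣≡0⇒i≡0 ∣x⊖y∣≡0))))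
      where
      x-y≡x⊖y : embed x - embed y ≡ toℕ x ⊖ toℕ y
      x-y≡x⊖y = ℤ.m-n≡m⊖n (toℕ x) (toℕ y)
      ∣x⊖y∣≡0 : ∣ toℕ x ⊖ toℕ y ∣ ≡ 0
      ∣x⊖y∣≡0 = p∣-small (subst (λ z → p ℕ.∣ ∣ z ∣) x-y≡x⊖y (∣⇒∣ᵤ p∣x-y))
                         (ℕ.≤-<-trans (ℤ.∣m⊝n∣≤m⊔n (toℕ x) (toℕ y)) (ℕ.⊔-lub (Fin.toℕ<n x) (Fin.toℕ<n y)))

    coefficients : ∀ {i} → Vec (Fin p) i → Fin i → ℤ
    coefficients x j = embed (lookup x j)

    reduce : ∀ {i} → (Fin i → ℤ) → Vec (Fin p) i
    reduce {zero}  y = []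
    reduce {suc i} y = fromℕ< (n%ℕd<d (y Fin.zero) p) ∷ reduce (y ∘ Fin.suc)

    p∣-sub-reduce : ∀ {i} (y : Fin i → ℤ) j → p∣ (y j - coefficients (reduce y) j)
    p∣-sub-reduce y Fin.zero = divides (y Fin.zero /ℕ p) (begin
      y Fin.zero - + toℕ (fromℕ< (n%ℕd<d (y Fin.zero) p)) ≡⟨ cong (λ r → y Fin.zero - + r) (Fin.toℕ-fromℕ< _) ⟩
      y Fin.zero - + (y Fin.zero %ℕ p)                    ≡⟨ cong (_- + (y Fin.zero %ℕ p)) (a≡a%ℕn+[a/ℕn]*n (y Fin.zero) p) ⟩
      + (y Fin.zero %ℕ p) + (y Fin.zero /ℕ p) * + p - + (y Fin.zero %ℕ p) ≡⟨ r+m-r≡m (+ (y Fin.zero %ℕ p)) ((y Fin.zero /ℕ p) * + p) ⟩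
      (y Fin.zero /ℕ p) * + p ∎)
      where open ≡-Reasoning
            r+m-r≡m : ∀ r m → r + m - r ≡ m
            r+m-r≡m = solve-∀
    p∣-sub-reduce y (Fin.suc j) = p∣-sub-reduce (y ∘ Fin.suc) j

    reduce-≡⇒p∣-sub : ∀ {i} (y y′ : Fin i → ℤ) j → lookup (reduce y) j ≡ lookup (reduce y′) j → p∣ (y j - y′ j)
    reduce-≡⇒p∣-sub y y′ j eq = subst p∣_ (cancel (y j) (y′ j) (coefficients (reduce y) j))
      (∣m∣n⇒∣m-n (p∣-sub-reduce y j) (subst (λ r → p∣ (y′ j - embed r)) (sym eq) (p∣-sub-reduce y′ j)))
      where cancel : ∀ a b r → a - r - (b - r) ≡ a - b
            cancel = solve-∀

  module Columns (p : ℕ) (p-prime : Prime p) (n : ℕ) where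

    open ModularArithmetic p p-prime public

    Column : Set
    Column = Vec (Fin p) n

    combination : ∀ {i} → Vec Column i → (Fin i → ℤ) → Fin n → ℤ
    combination []       y k = 0ℤ
    combination (c ∷ cs) y k = y Fin.zero * embed (lookup c k) + combination cs (y ∘ Fin.suc) k

    combination-cong : ∀ {i} (cs : Vec Column i) {x y} → (∀ j → x j ≡ y j) → ∀ k → combination cs x k ≡ combination cs y k
    combination-cong []       x≗y k = refl
    combination-cong (c ∷ cs) x≗y k = cong₂ _+_ (cong (_* embed (lookup c k)) (x≗y Fin.zero)) (combination-cong cs (x≗y ∘ Fin.suc) k)

    combination-linear : ∀ {i} (cs : Vec Column i) u v x y k →
      combination cs (λ j → u * x j - v * y j) k ≡ u * combination cs x k - v * combination cs y k
    combination-linear []       u v x y k = u*0-v*0≡0 u v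
      where u*0-v*0≡0 : ∀ u v → 0ℤ ≡ u * 0ℤ - v * 0ℤ
            u*0-v*0≡0 = solve-∀
    combination-linear (c ∷ cs) u v x y k
      rewrite combination-linear cs u v (x ∘ Fin.suc) (y ∘ Fin.suc) k =
        step u v (x Fin.zero) (y Fin.zero) (embed (lookup c k)) (combination cs (x ∘ Fin.suc) k) (combination cs (y ∘ Fin.suc) k)
      where step : ∀ u v a b e X Y → (u * a - v * b) * e + (u * X - v * Y) ≡ u * (a * e + X) - v * (b * e + Y)
            step = solve-∀

    combination-sub : ∀ {i} (cs : Vec Column i) x y k → combination cs (λ j → x j - y j) k ≡ combination cs x k - combination cs y k
    combination-sub cs x y k =
      trans (combination-cong cs (λ j → a-b≡1a-1b (x j) (y j)) k)
            (trans (combination-linear cs (+ 1) (+ 1) x y k) (sym (a-b≡1a-1b (combination cs x k) (combination cs y k))))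
      where a-b≡1a-1b : ∀ a b → a - b ≡ + 1 * a - + 1 * b
            a-b≡1a-1b = solve-∀

    p∣-combination : ∀ {i} (cs : Vec Column i) x → (∀ j → p∣ x j) → ∀ k → p∣ combination cs x k
    p∣-combination []       x p∣x k = p∣0
    p∣-combination (c ∷ cs) x p∣x k = ∣m∣n⇒∣m+n (∣m⇒∣m*n _ (p∣x Fin.zero)) (p∣-combination cs (x ∘ Fin.suc) (p∣x ∘ Fin.suc) k)

    p∣-combination-reduce : ∀ {i} (cs : Vec Column i) y k → p∣ (combination cs y k - combination cs (coefficients (reduce y)) k)
    p∣-combination-reduce cs y k = subst p∣_ (combination-sub cs y (coefficients (reduce y)) k)
                                            (p∣-combination cs _ (p∣-sub-reduce y) k)

    -- Linear independence over F_p, tested on integer combinations of the representatives.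
    Independent : ∀ {i} → Vec Column i → Set
    Independent {i} cs = ∀ (x : Vec (Fin p) i) → (∀ k → p∣ combination cs (coefficients x) k) → ∀ j → toℕ (lookup x j) ≡ 0

    independent? : ∀ {i} (cs : Vec Column i) → Dec (Independent cs)
    independent? cs = ∀-vector? λ x → Fin.all? (λ k → p∣? (combination cs (coefficients x) k)) →-dec Fin.all? (λ j → toℕ (lookup x j) ℕ.≟ 0)

    Pivots : ∀ {i} → Vec Column i → List (Fin n) → Set
    Pivots cs T = ∀ y → (∀ {t} → t ∈ T → p∣ combination cs y t) → ∀ k → p∣ combination cs y k

    private
      Escape : ∀ {i} → Column → Vec Column i → List (Fin n) → Vec (Fin p) (suc i) → Set
      Escape c cs T x = All (λ t → p∣ combination (c ∷ cs) (coefficients x) t) T ×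
                        ∃ λ k → ¬ p∣ combination (c ∷ cs) (coefficients x) k

      escape? : ∀ {i} (c : Column) (cs : Vec Column i) T → Decidable (Escape c cs T)
      escape? c cs T x = All.all? (λ t → p∣? (combination (c ∷ cs) (coefficients x) t)) T
                    ×-dec Fin.any? (λ k → ¬? (p∣? (combination (c ∷ cs) (coefficients x) k)))

      pivots-∷-without-escape : ∀ {i} c (cs : Vec Column i) T → ¬ ∃ (Escape c cs T) → Pivots (c ∷ cs) T
      pivots-∷-without-escape c cs T ¬escape y p∣y k = decidable-stable (p∣? _) λ ¬p∣yk →
        ¬escape (reduce y ,
                 All.tabulate (λ t∈ → p∣-sub-cancelˡ (p∣y t∈) (p∣-combination-reduce (c ∷ cs) y _)) ,
                 k , λ p∣xk → ¬p∣yk (p∣-sub-cancelʳ p∣xk (p∣-combination-reduce (c ∷ cs) y k)))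

      -- Eliminating the head coefficient between y and the escaping x leaves a combination of cs.
      pivots-∷-with-escape : ∀ {i} c (cs : Vec Column i) T → Pivots cs T →
                             ∀ x → All (λ t → p∣ combination (c ∷ cs) (coefficients x) t) T →
                             ∀ k → ¬ p∣ combination (c ∷ cs) (coefficients x) k → Pivots (c ∷ cs) (k ∷ T)
      pivots-∷-with-escape c cs T pivots x p∣x k ¬p∣xk y p∣y k′ =
        subst p∣_ (sym (y≡ k′)) (∣m∣n⇒∣m+n (∣n⇒∣m*n (e k′) p∣a) (p∣Y k′))
        where
        a b : ℤ
        a = y Fin.zero
        b = coefficients x Fin.zero
        e Y : Fin n → ℤ
        e t = embed (lookup c t)
        Y = combination cs (y ∘ Fin.suc)
        y≡ : ∀ t → combination (c ∷ cs) y t ≡ e t * a + Y t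
        y≡ t = cong (_+ Y t) (ℤ.*-comm a (e t))
        z : Fin _ → ℤ
        z j = b * y (Fin.suc j) - a * coefficients x (Fin.suc j)
        z≡ : ∀ t → combination cs z t ≡ b * combination (c ∷ cs) y t - a * combination (c ∷ cs) (coefficients x) t
        z≡ t = trans (combination-linear cs b a (y ∘ Fin.suc) (coefficients x ∘ Fin.suc) t)
                     (head-cancels a b (e t) _ _)
          where head-cancels : ∀ a b e Y X → b * Y - a * X ≡ b * (a * e + Y) - a * (b * e + X)
                head-cancels = solve-∀
        p∣z : ∀ t → p∣ combination cs z t
        p∣z = pivots z λ t∈ → subst p∣_ (sym (z≡ _)) (∣m∣n⇒∣m-n (∣n⇒∣m*n b (p∣y (there t∈))) (∣n⇒∣m*n a (All.lookup p∣x t∈)))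
        p∣a : p∣ a
        p∣a = [ (λ p∣a → p∣a) , ⊥-elim ∘ ¬p∣xk ]′
                (p∣-* a _ (p∣-sub-cancelˡ (∣n⇒∣m*n b (p∣y (here refl))) (subst p∣_ (z≡ k) (p∣z k))))
        p∣Y : ∀ t → p∣ Y t
        p∣Y = pivots (y ∘ Fin.suc) λ {t} t∈ →
                subst p∣_ (trans (cong (_- e t * a) (y≡ t)) (ea+Y-ea≡Y (e t * a) (Y t)))
                      (∣m∣n⇒∣m-n (p∣y (there t∈)) (∣n⇒∣m*n (e t) p∣a))
          where ea+Y-ea≡Y : ∀ u v → u + v - u ≡ v
                ea+Y-ea≡Y = solve-∀

    pivots-exist : ∀ {i} (cs : Vec Column i) → ∃ λ T → length T ≤ i × Pivots cs T
    pivots-exist []       = [] , z≤n , λ _ _ _ → p∣0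
    pivots-exist (c ∷ cs) with pivots-exist cs
    ... | T , |T|≤i , pivots with ∃-vector? (escape? c cs T)
    ...   | yes (x , p∣x , k , ¬p∣xk) = k ∷ T , s≤s |T|≤i , pivots-∷-with-escape c cs T pivots x p∣x k ¬p∣xk
    ...   | no ¬escape                = T , ℕ.m≤n⇒m≤1+n |T|≤i , pivots-∷-without-escape c cs T ¬escape

    lookup-injective : ∀ {A : Set} {m} {v w : Vec A m} → (∀ j → lookup v j ≡ lookup w j) → v ≡ w
    lookup-injective {v = v} {w} v≗w = trans (sym (Vec.tabulate∘lookup v)) (trans (Vec.tabulate-cong v≗w) (Vec.tabulate∘lookup w))

    dependence : ∀ {i} (w : Column) (cs : Vec Column i) → Independent cs → ¬ Independent (w ∷ cs) →
                 ∃ λ (h : Fin p) → ∃ λ (x : Vec (Fin p) i) →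
                 (∀ k → p∣ combination (w ∷ cs) (coefficients (h ∷ x)) k) × ¬ p∣ embed h
    dependence w cs independent dependent
      with ¬∀⇒∃¬-vector (λ x → Fin.all? (λ k → p∣? (combination (w ∷ cs) (coefficients x) k))
                                →-dec Fin.all? (λ j → toℕ (lookup x j) ℕ.≟ 0)) dependent
    ... | h ∷ x , nontrivial = h , x , relation , ¬p∣h
      where
      relation : ∀ k → p∣ combination (w ∷ cs) (coefficients (h ∷ x)) k
      relation k = decidable-stable (p∣? _) λ ¬p∣k → nontrivial λ all → ⊥-elim (¬p∣k (all k))
      ¬p∣h : ¬ p∣ embed h
      ¬p∣h p∣h = nontrivial λ _ → all-zero
        where
        all-zero : ∀ j → toℕ (lookup (h ∷ x) j) ≡ 0
        all-zero Fin.zero    = p∣embed⇒zero h p∣h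
        all-zero (Fin.suc j) = independent x (λ k → subst p∣_ (hw+X-hw≡X (embed h * embed (lookup w k)) _)
                                                    (∣m∣n⇒∣m-n (relation k) (∣m⇒∣m*n _ p∣h))) j
          where hw+X-hw≡X : ∀ a b → a + b - a ≡ b
                hw+X-hw≡X = solve-∀

    -- Eliminating w and w′ between their dependences h w + X ≡ 0 and h′ w′ + X′ ≡ 0 gives a combination
    -- h′ X - h X′ of cs, which vanishes on T and hence everywhere; so h h′ (w - w′) ≡ 0.
    dependent-unique : ∀ {i} (cs : Vec Column i) T → Independent cs → Pivots cs T → (w w′ : Column) →
                       ¬ Independent (w ∷ cs) → ¬ Independent (w′ ∷ cs) →
                       (∀ {t} → t ∈ T → lookup w t ≡ lookup w′ t) → w ≡ w′
    dependent-unique cs T independent pivots w w′ dep dep′ agree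
      with dependence w cs independent dep | dependence w′ cs independent dep′
    ... | h , x , p∣F , ¬p∣h | h′ , x′ , p∣F′ , ¬p∣h′ =
      lookup-injective λ k → p∣embed-sub⇒≡ _ _ (p∣e-e′ k)
      where
      e e′ X X′ : Fin n → ℤ
      e k = embed (lookup w k)
      e′ k = embed (lookup w′ k)
      X = combination cs (coefficients x)
      X′ = combination cs (coefficients x′)
      F F′ : Fin n → ℤ
      F k = embed h * e k + X k
      F′ k = embed h′ * e′ k + X′ k
      p∣h′F-hF′ : ∀ k → p∣ (embed h′ * F k - embed h * F′ k)
      p∣h′F-hF′ k = ∣m∣n⇒∣m-n (∣n⇒∣m*n (embed h′) (p∣F k)) (∣n⇒∣m*n (embed h) (p∣F′ k))
      z : Fin _ → ℤ
      z j = embed h′ * coefficients x j - embed h * coefficients x′ j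
      z≡ : ∀ k → combination cs z k ≡ (embed h′ * F k - embed h * F′ k) - embed h * (embed h′ * (e k - e′ k))
      z≡ k = trans (combination-linear cs (embed h′) (embed h) (coefficients x) (coefficients x′) k)
                   (regroup (embed h) (embed h′) (e k) (e′ k) (X k) (X′ k))
        where regroup : ∀ b b′ e e′ X X′ → b′ * X - b * X′ ≡ (b′ * (b * e + X) - b * (b′ * e′ + X′)) - b * (b′ * (e - e′))
              regroup = solve-∀
      p∣z : ∀ k → p∣ combination cs z k
      p∣z = pivots z λ {t} t∈ → subst p∣_ (sym (z≡ t))
              (∣m∣n⇒∣m-n (p∣h′F-hF′ t) (∣n⇒∣m*n (embed h) (∣n⇒∣m*n (embed h′) (subst p∣_ (sym (ℤ.i≡j⇒i-j≡0 (cong embed (agree t∈)))) p∣0))))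
      p∣e-e′ : ∀ k → p∣ (e k - e′ k)
      p∣e-e′ k = p∣-*-cancelˡ (embed h′) _ ¬p∣h′ (p∣-*-cancelˡ (embed h) _ ¬p∣h
                   (p∣-sub-cancelˡ (p∣h′F-hF′ k) (subst p∣_ (z≡ k) (p∣z k))))

module ExtensionCounting where

  open Counting
  open Weights
  open LinearAlgebraModP
  open import Data.Empty using (⊥-elim)
  open import Data.Fin as Fin using (Fin; toℕ)
  import Data.Fin.Properties as Fin
  open import Data.List using (List; _∷_; length; filter; allFin)
  open import Data.List.Membership.Propositional using (_∈_; _∉_)
  open import Data.List.Membership.Propositional.Properties using (∈-filter⁻; ∈-filter⁺)
  import Data.List.Membership.DecPropositional as DecMembership
  open import Data.List.Relation.Unary.All as All using (All)
  import Data.List.Relation.Unary.Unique.Propositional.Properties as Unique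
  open import Data.Nat using (ℕ; zero; suc; _+_; _*_; _∸_; _^_; _≤_; z≤n; s≤s)
  open import Data.Nat.Combinatorics using (_C_)
  open import Data.Nat.Primality using (Prime)
  open import Data.Nat.Properties using (+-comm; *-identityʳ; *-zeroʳ; +-monoʳ-≤; *-monoʳ-≤; *-cancelˡ-≤; ∸-monoʳ-≤; m≤n+o⇒m∸n≤o; module ≤-Reasoning)
  open import Data.Nat.Tactic.RingSolver using (solve-∀)
  open import Data.Product using (_×_; _,_; proj₁; proj₂)
  open import Data.Vec using (Vec; _∷_; lookup; _[_]≔_)
  import Data.Vec.Properties as Vec
  open import Function using (id)
  open import Relation.Binary.PropositionalEquality using (_≡_; _≢_; refl; sym; trans; cong; subst)
  open import Relation.Nullary using (Dec; yes; no; ¬_)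
  open import Relation.Nullary.Decidable using (¬?; _×-dec_; decidable-stable)
  open import Relation.Unary using (Decidable)

  -- q times the i-th factor of the bound for p = b + 2, q = m + 1 and weight s + 1,
  -- using (p-1)^(s+1) - (p-1)^s = (p-1)^s (p-2).
  factor : (b m s i : ℕ) → ℕ
  factor b m s i = (suc m C suc s) * (suc b ^ s * b) * (suc m ∸ i)

  module Extensions (b : ℕ) (p-prime : Prime (suc (suc b))) (m : ℕ) where

    private
      p = suc (suc b)
      q = suc m

    open Columns p p-prime q

    extends? : ∀ {i} s (cs : Vec Column i) → Decidable (λ v → weight v ≡ s × Independent (v ∷ cs))
    extends? s cs v = weight≟ s v ×-dec independent? (v ∷ cs)

    extensions : ∀ {i} s → Vec Column i → List Column
    extensions s cs = filter (extends? s cs) (allVectors p q)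

    private
      one : Fin p
      one = Fin.suc Fin.zero

    -- Off the pivots, setting a large entry of a dependent column to 1 makes it independent:
    -- otherwise both columns would be dependent and agree on the pivots.
    module Repair {i} (cs : Vec Column i) (independent : Independent cs) (T : List (Fin q)) (pivots : Pivots cs T)
                  (j : Fin q) (j∉T : j ∉ T) where

      repair : (w : Column) → Dec (Independent (w ∷ cs)) → Column
      repair w (yes _) = w
      repair w (no _)  = w [ j ]≔ one

      private
        large≢one : ∀ {x : Fin p} → Large x → x ≢ one
        large≢one (s≤s ()) refl

        large≢zero : ∀ {x : Fin p} → Large x → toℕ x ≢ 0
        large≢zero large x≡0 with () ← subst (2 ≤_) x≡0 large

        agree-off-j : ∀ (w : Column) {t} → t ∈ T → lookup (w [ j ]≔ one) t ≡ lookup w t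
        agree-off-j w t∈T = Vec.lookup∘update′ (λ { refl → j∉T t∈T }) w one

        updated-independent : ∀ w → Large (lookup w j) → ¬ Independent (w ∷ cs) → Independent ((w [ j ]≔ one) ∷ cs)
        updated-independent w large dependent = decidable-stable (independent? ((w [ j ]≔ one) ∷ cs)) λ dependent′ →
          large≢one large (trans (cong (λ v → lookup v j)
                                       (dependent-unique cs T independent pivots w (w [ j ]≔ one) dependent dependent′ (λ t∈T → sym (agree-off-j w t∈T))))
                                 (Vec.lookup∘update j w one))

      repair-independent : ∀ w d → Large (lookup w j) → Independent (repair w d ∷ cs)
      repair-independent w (yes independent′) _     = independent′
      repair-independent w (no dependent)     large = updated-independent w large dependent

      repair-weight : ∀ w d → Large (lookup w j) → weight (repair w d) ≡ weight w
      repair-weight w (yes _) _     = refl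
      repair-weight w (no _)  large = weight-update w j (large≢zero large)

      repair-nonzero : ∀ w d → Large (lookup w j) → toℕ (lookup (repair w d) j) ≢ 0
      repair-nonzero w (yes _) large = large≢zero large
      repair-nonzero w (no _)  _     = subst (λ x → toℕ x ≢ 0) (sym (Vec.lookup∘update j w one)) λ ()

      repair-injective : ∀ w w′ d d′ → Large (lookup w j) → Large (lookup w′ j) → repair w d ≡ repair w′ d′ → w ≡ w′
      repair-injective w w′ (yes _) (yes _) _ _ eq = eq
      repair-injective w w′ (yes _) (no _)  large _ eq =
        ⊥-elim (large≢one large (trans (cong (λ v → lookup v j) eq) (Vec.lookup∘update j w′ one)))
      repair-injective w w′ (no _)  (yes _) _ large′ eq =
        ⊥-elim (large≢one large′ (trans (cong (λ v → lookup v j) (sym eq)) (Vec.lookup∘update j w one)))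
      repair-injective w w′ (no dependent) (no dependent′) _ _ eq =
        dependent-unique cs T independent pivots w w′ dependent dependent′ λ t∈T →
          trans (sym (agree-off-j w t∈T)) (trans (cong (λ v → lookup v _) eq) (agree-off-j w′ t∈T))

    open DecMembership (Fin._≟_ {q}) using (_∈?_)

    private
      a = suc b

    module _ {i} (cs : Vec Column i) (independent : Independent cs) (T : List (Fin q)) (pivots : Pivots cs T) (s : ℕ) where

      count-weight-large≤count-nonzero : ∀ j → j ∉ T →
        count (weight-large? (suc s) j) (allVectors p q) ≤ count (nonzero? j) (extensions (suc s) cs)
      count-weight-large≤count-nonzero j j∉T =
        length-≤-of-injection (λ w → repair w (independent? (w ∷ cs))) (Unique.filter⁺ (weight-large? (suc s) j) (allVectors-unique q))
          (λ {w} {w′} w∈ w′∈ → repair-injective w w′ (independent? (w ∷ cs)) (independent? (w′ ∷ cs)) (large w∈) (large w′∈))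
          (λ {w} w∈ → ∈-filter⁺ (nonzero? j)
            (∈-filter⁺ (extends? (suc s) cs) (∈-allVectors (repair w (independent? (w ∷ cs))))
              (trans (repair-weight w (independent? (w ∷ cs)) (large w∈)) (proj₁ (proj₂ (∈-filter⁻ (weight-large? (suc s) j) {xs = allVectors p q} w∈))) ,
               repair-independent w (independent? (w ∷ cs)) (large w∈)))
            (repair-nonzero w (independent? (w ∷ cs)) (large w∈)))
        where
        open Repair cs independent T pivots j j∉T
        large : ∀ {w} → w ∈ filter (weight-large? (suc s) j) (allVectors p q) → Large (lookup w j)
        large w∈ = proj₂ (proj₂ (∈-filter⁻ (weight-large? (suc s) j) {xs = allVectors p q} w∈))

      off-pivots : q ∸ length T ≤ ∑[ j < q ] indicator (¬? (j ∈? T))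
      off-pivots = m≤n+o⇒m∸n≤o q (length T) (begin
        q                                                                          ≡⟨ sym (trans (sum-cong-≗ λ j → indicator-¬?+indicator (j ∈? T)) (trans (sum-const q 1) (*-identityʳ q))) ⟩
        (∑[ j < q ] (indicator (¬? (j ∈? T)) + indicator (j ∈? T)))                 ≡⟨ ∑-distrib-+ (λ j → indicator (¬? (j ∈? T))) (λ j → indicator (j ∈? T)) ⟩
        (∑[ j < q ] indicator (¬? (j ∈? T))) + (∑[ j < q ] indicator (j ∈? T))      ≤⟨ +-monoʳ-≤ (∑[ j < q ] indicator (¬? (j ∈? T))) on-pivots ⟩
        (∑[ j < q ] indicator (¬? (j ∈? T))) + length T                            ≡⟨ +-comm (∑[ j < q ] indicator (¬? (j ∈? T))) (length T) ⟩
        length T + ∑[ j < q ] indicator (¬? (j ∈? T)) ∎)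
        where
        open ≤-Reasoning
        indicator-¬?+indicator : ∀ {A : Set} (d : Dec A) → indicator (¬? d) + indicator d ≡ 1
        indicator-¬?+indicator (yes _) = refl
        indicator-¬?+indicator (no _)  = refl
        on-pivots : ∑[ j < q ] indicator (j ∈? T) ≤ length T
        on-pivots = subst (_≤ length T) (count-tabulate (_∈? T) id)
          (length-≤-of-injection id (Unique.filter⁺ (_∈? T) (Unique.allFin⁺ q)) (λ _ _ eq → eq)
            (λ j∈ → proj₂ (∈-filter⁻ (_∈? T) {xs = allFin q} j∈)))

      double-counting-bound : (m C s) * a ^ s * b * (q ∸ length T) ≤ suc s * length (extensions (suc s) cs)
      double-counting-bound = begin
        K * (q ∸ length T)                                       ≤⟨ *-monoʳ-≤ K off-pivots ⟩
        K * (∑[ j < q ] indicator (¬? (j ∈? T)))                 ≡⟨ *-distribˡ-sum K (λ j → indicator (¬? (j ∈? T))) ⟩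
        (∑[ j < q ] (K * indicator (¬? (j ∈? T))))               ≤⟨ sum-mono-≤ per-coordinate ⟩
        (∑[ j < q ] count (nonzero? j) (extensions (suc s) cs))  ≡⟨ sym (double-counting (extensions (suc s) cs) weights) ⟩
        suc s * length (extensions (suc s) cs)                   ∎
        where
        open ≤-Reasoning
        K = (m C s) * a ^ s * b
        weights : All (λ v → weight v ≡ suc s) (extensions (suc s) cs)
        weights = All.tabulate λ v∈ → proj₁ (proj₂ (∈-filter⁻ (extends? (suc s) cs) {xs = allVectors p q} v∈))
        per-coordinate : ∀ j → K * indicator (¬? (j ∈? T)) ≤ count (nonzero? j) (extensions (suc s) cs)
        per-coordinate j with j ∈? T
        ... | yes _   = subst (_≤ count (nonzero? j) (extensions (suc s) cs)) (sym (*-zeroʳ K)) z≤n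
        ... | no j∉T  = subst (_≤ count (nonzero? j) (extensions (suc s) cs)) (trans (count-weight-large {b = b} m s j) (sym (*-identityʳ K)))
                                     (count-weight-large≤count-nonzero j j∉T)

    extensions-bound : ∀ {i} (cs : Vec Column i) → Independent cs → ∀ s →
                       factor b m s i ≤ q * length (extensions (suc s) cs)
    extensions-bound {i} cs independent s with pivots-exist cs
    ... | T , |T|≤i , pivots = *-cancelˡ-≤ (suc s) (begin
      suc s * ((q C suc s) * (a ^ s * b) * (q ∸ i))   ≡⟨ reassociate (suc s) (q C suc s) (a ^ s * b) (q ∸ i) ⟩
      (suc s * (q C suc s)) * (a ^ s * b) * (q ∸ i)   ≡⟨ cong (λ c → c * (a ^ s * b) * (q ∸ i)) (sym ([1+n]*nCk≡[1+k]*[1+n]C[1+k] m s)) ⟩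
      (q * (m C s)) * (a ^ s * b) * (q ∸ i)           ≡⟨ regroup q (m C s) (a ^ s) b (q ∸ i) ⟩
      q * ((m C s) * a ^ s * b * (q ∸ i))             ≤⟨ *-monoʳ-≤ q (*-monoʳ-≤ ((m C s) * a ^ s * b) (∸-monoʳ-≤ q |T|≤i)) ⟩
      q * ((m C s) * a ^ s * b * (q ∸ length T))      ≤⟨ *-monoʳ-≤ q (double-counting-bound cs independent T pivots s) ⟩
      q * (suc s * length (extensions (suc s) cs))    ≡⟨ swap q (suc s) _ ⟩
      suc s * (q * length (extensions (suc s) cs))    ∎)
      where
      open ≤-Reasoning
      reassociate : ∀ x y z w → x * (y * z * w) ≡ x * y * z * w
      reassociate = solve-∀
      regroup : ∀ x y z u w → x * y * (z * u) * w ≡ x * (y * z * u * w)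
      regroup = solve-∀
      swap : ∀ x y z → x * (y * z) ≡ y * (x * z)
      swap = solve-∀

module ColumnTuples where

  open Counting
  open Weights
  open LinearAlgebraModP
  open ExtensionCounting
  open import Data.Empty using (⊥)
  open import Data.Fin as Fin using (Fin)
  open import Data.List using (List; []; _∷_; _++_; length; map)
  import Data.List.Properties as List
  open import Data.List.Membership.Propositional using (_∈_)
  open import Data.List.Membership.Propositional.Properties using (∈-++⁻; ∈-map⁻; ∈-filter⁻)
  open import Data.List.Relation.Unary.All as All using (All)
  open import Data.List.Relation.Unary.Any using (here; there)
  open import Data.List.Relation.Unary.Unique.Propositional using (Unique; []; _∷_)
  import Data.List.Relation.Unary.Unique.Propositional.Properties as Unique
  open import Data.Nat using (ℕ; zero; suc; _+_; _*_; _^_; _≤_; z≤n; s≤s)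
  open import Data.Nat.Primality using (Prime)
  open import Data.Nat.Properties using (+-mono-≤; *-distribˡ-+; *-monoˡ-≤; *-monoʳ-≤; *-assoc; module ≤-Reasoning)
  open import Data.Nat.Tactic.RingSolver using (solve-∀)
  open import Data.Product using (∃; _×_; _,_; proj₁; proj₂)
  open import Data.Sum using (inj₁; inj₂)
  open import Data.Vec using (Vec; []; _∷_; lookup)
  import Data.Vec.Properties as Vec
  open import Relation.Binary.PropositionalEquality using (_≡_; refl; sym; trans; cong)

  ∏ : ℕ → (ℕ → ℕ) → ℕ
  ∏ zero    f = 1
  ∏ (suc r) f = ∏ r f * f r

  module Tuples (b : ℕ) (p-prime : Prime (suc (suc b))) (m s : ℕ) where

    private
      q = suc m

    open Columns (suc (suc b)) p-prime q
    open Extensions b p-prime m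

    Admissible : ∀ {i} → Vec Column i → Set
    Admissible cs = Independent cs × (∀ j → weight (lookup cs j) ≡ suc s)

    extendAll : ∀ {i} → List (Vec Column i) → List (Vec Column (suc i))
    extendAll []         = []
    extendAll (cs ∷ css) = map (_∷ cs) (extensions (suc s) cs) ++ extendAll css

    ∈-extendAll⁻ : ∀ {i} {css : List (Vec Column i)} {ds} → ds ∈ extendAll css →
                   ∃ λ cs → ∃ λ v → cs ∈ css × v ∈ extensions (suc s) cs × ds ≡ v ∷ cs
    ∈-extendAll⁻ {css = cs ∷ css} ds∈ with ∈-++⁻ (map (_∷ cs) (extensions (suc s) cs)) ds∈
    ... | inj₁ ds∈map with ∈-map⁻ (_∷ cs) ds∈map
    ...   | v , v∈ , refl = cs , v , here refl , v∈ , refl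
    ∈-extendAll⁻ {css = cs ∷ css} ds∈ | inj₂ ds∈rest with ∈-extendAll⁻ ds∈rest
    ...   | cs′ , v , cs′∈ , v∈ , eq = cs′ , v , there cs′∈ , v∈ , eq

    extendAll-unique : ∀ {i} {css : List (Vec Column i)} → Unique css → Unique (extendAll css)
    extendAll-unique {css = []}       _          = []
    extendAll-unique {css = cs ∷ css} (cs∉ ∷ !css) =
      Unique.++⁺ (Unique.map⁺ {f = _∷ cs} Vec.∷-injectiveˡ (Unique.filter⁺ (extends? (suc s) cs) (allVectors-unique q)))
                 (extendAll-unique !css) disjoint
      where
      disjoint : ∀ {ds} → ds ∈ map (_∷ cs) (extensions (suc s) cs) × ds ∈ extendAll css → ⊥
      disjoint (ds∈map , ds∈rest) with ∈-map⁻ (_∷ cs) ds∈map | ∈-extendAll⁻ {css = css} ds∈rest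
      ... | v , _ , refl | cs′ , v′ , cs′∈ , _ , eq = All.lookup cs∉ cs′∈ (Vec.∷-injectiveʳ eq)

    tuples : ∀ i → List (Vec Column i)
    tuples zero    = [] ∷ []
    tuples (suc i) = extendAll (tuples i)

    tuples-unique : ∀ i → Unique (tuples i)
    tuples-unique zero    = All.[] ∷ []
    tuples-unique (suc i) = extendAll-unique (tuples-unique i)

    tuples-admissible : ∀ i {cs} → cs ∈ tuples i → Admissible cs
    tuples-admissible zero    (here refl) = (λ _ _ ()) , λ ()
    tuples-admissible (suc i) cs∈ with ∈-extendAll⁻ {css = tuples i} cs∈
    ... | cs , v , cs∈ , v∈ , refl = proj₂ extends , weights
      where
      extends = proj₂ (∈-filter⁻ (extends? (suc s) cs) {xs = allVectors (suc (suc b)) q} v∈)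
      weights : ∀ j → weight (lookup (v ∷ cs) j) ≡ suc s
      weights Fin.zero    = proj₁ extends
      weights (Fin.suc j) = proj₂ (tuples-admissible i cs∈) j

    length-extendAll : ∀ {i} c (css : List (Vec Column i)) → (∀ {cs} → cs ∈ css → c ≤ q * length (extensions (suc s) cs)) →
                       length css * c ≤ q * length (extendAll css)
    length-extendAll c []         _     = z≤n
    length-extendAll c (cs ∷ css) bound = begin
      c + length css * c                                                      ≤⟨ +-mono-≤ (bound (here refl)) (length-extendAll c css (λ cs∈ → bound (there cs∈))) ⟩
      q * length (extensions (suc s) cs) + q * length (extendAll css)          ≡⟨ sym (*-distribˡ-+ q (length (extensions (suc s) cs)) (length (extendAll css))) ⟩
      q * (length (extensions (suc s) cs) + length (extendAll css))            ≡⟨ cong (q *_) (sym (trans (List.length-++ (map (_∷ cs) (extensions (suc s) cs))) (cong (_+ length (extendAll css)) (List.length-map (_∷ cs) (extensions (suc s) cs))))) ⟩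
      q * length (extendAll (cs ∷ css)) ∎
      where open ≤-Reasoning

    tuples-bound : ∀ i → ∏ i (factor b m s) ≤ q ^ i * length (tuples i)
    tuples-bound zero    = s≤s z≤n
    tuples-bound (suc i) = begin
      ∏ i (factor b m s) * factor b m s i           ≤⟨ *-monoˡ-≤ (factor b m s i) (tuples-bound i) ⟩
      q ^ i * length (tuples i) * factor b m s i    ≡⟨ *-assoc (q ^ i) (length (tuples i)) (factor b m s i) ⟩
      q ^ i * (length (tuples i) * factor b m s i)  ≤⟨ *-monoʳ-≤ (q ^ i) (length-extendAll (factor b m s i) (tuples i) λ {cs} cs∈ →
                                                          extensions-bound cs (proj₁ (tuples-admissible i cs∈)) s) ⟩
      q ^ i * (q * length (tuples (suc i)))         ≡⟨ shuffle (q ^ i) q (length (tuples (suc i))) ⟩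
      q ^ suc i * length (tuples (suc i))           ∎
      where open ≤-Reasoning
            shuffle : ∀ x y z → x * (y * z) ≡ y * x * z
            shuffle = solve-∀

module SquareCase where

  open Counting using (length-≤-of-injection)
  open Weights
  open LinearAlgebraModP
  import Algebra.Properties.Semiring.Sum as SemiringSum
  open import Data.Fin as Fin using (Fin; toℕ; punchOut)
  import Data.Fin.Properties as Fin
  open import Data.Integer as ℤ using (ℤ; _+_; _-_; _*_; 0ℤ)
  import Data.Integer.Properties as ℤ
  open import Data.Integer.Divisibility.Signed using (∣m∣n⇒∣m+n; ∣m∣n⇒∣m-n; ∣n⇒∣m*n; ∣m+n∣m⇒∣n; ∣m+n∣n⇒∣m)
  open import Data.Integer.Tactic.RingSolver using (solve-∀)
  open import Data.Nat as ℕ using (ℕ; zero; suc; nonTrivial⇒n>1)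
  import Data.Nat.Properties as ℕ
  open import Data.Nat.Properties using (^-monoʳ-<)
  open import Data.Nat.Primality using (Prime; prime⇒nonTrivial)
  open import Data.Vec using (Vec; []; _∷_; lookup; removeAt)
  import Data.Vec.Properties as Vec
  open import Function using (_∘_)
  open import Relation.Binary.PropositionalEquality using (_≡_; _≢_; refl; sym; trans; cong; subst; subst₂)
  open import Relation.Nullary using (¬_; yes; no)
  open import Relation.Nullary.Decidable using (decidable-stable)

  module ℤΣ = SemiringSum ℤ.+-*-semiring

  dot : ∀ {n} → (Fin n → ℤ) → (Fin n → ℤ) → ℤ
  dot y v = ℤΣ.sum (λ t → y t * v t)

  dot-sub : ∀ {n} (y u v : Fin n → ℤ) → dot y (λ t → u t - v t) ≡ dot y u - dot y v
  dot-sub {zero}  y u v = refl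
  dot-sub {suc n} y u v =
    trans (cong (y Fin.zero * (u Fin.zero - v Fin.zero) +_) (dot-sub (y ∘ Fin.suc) (u ∘ Fin.suc) (v ∘ Fin.suc)))
          (interchange (y Fin.zero) (u Fin.zero) (v Fin.zero) (dot (y ∘ Fin.suc) (u ∘ Fin.suc)) (dot (y ∘ Fin.suc) (v ∘ Fin.suc)))
    where interchange : ∀ y a b c d → y * (a - b) + (c - d) ≡ (y * a + c) - (y * b + d)
          interchange = solve-∀

  module SquareMatrices (p : ℕ) (p-prime : Prime p) (m : ℕ) where

    private
      n = suc m

    open Columns p p-prime n public

    p∣-sum : ∀ {k} (g : Fin k → ℤ) → (∀ t → p∣ g t) → p∣ ℤΣ.sum g
    p∣-sum {zero}  g p∣g = p∣0
    p∣-sum {suc k} g p∣g = ∣m∣n⇒∣m+n (p∣g Fin.zero) (p∣-sum (g ∘ Fin.suc) (p∣g ∘ Fin.suc))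

    p∣-sum-single : ∀ {k} (g : Fin k → ℤ) i → (∀ t → t ≢ i → p∣ g t) → p∣ ℤΣ.sum g → p∣ g i
    p∣-sum-single {suc k} g Fin.zero    p∣g p∣∑ =
      ∣m+n∣n⇒∣m p∣∑ (p∣-sum (g ∘ Fin.suc) (λ t → p∣g (Fin.suc t) λ ()))
    p∣-sum-single {suc k} g (Fin.suc i) p∣g p∣∑ =
      p∣-sum-single (g ∘ Fin.suc) i (λ t t≢i → p∣g (Fin.suc t) (t≢i ∘ Fin.suc-injective))
                    (∣m+n∣m⇒∣n p∣∑ (p∣g Fin.zero λ ()))

    column : Column → Fin n → ℤ
    column c t = embed (lookup c t)

    dot-combination : ∀ {i} (cs : Vec Column i) y → (∀ j → p∣ dot y (column (lookup cs j))) → ∀ x → p∣ dot y (combination cs x)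
    dot-combination []       y _   x = p∣-sum (λ t → y t * 0ℤ) λ t → ∣n⇒∣m*n (y t) p∣0
    dot-combination (c ∷ cs) y p∣y x = subst p∣_ (sym split)
      (∣m∣n⇒∣m+n (∣n⇒∣m*n (x Fin.zero) (p∣y Fin.zero)) (dot-combination cs y (p∣y ∘ Fin.suc) (x ∘ Fin.suc)))
      where
      split : dot y (combination (c ∷ cs) x) ≡ x Fin.zero * dot y (column c) + dot y (combination cs (x ∘ Fin.suc))
      split = trans (ℤΣ.sum-cong-≗ λ t → distribute (y t) (x Fin.zero) (column c t) (combination cs (x ∘ Fin.suc) t))
             (trans (ℤΣ.∑-distrib-+ (λ t → x Fin.zero * (y t * column c t)) (λ t → y t * combination cs (x ∘ Fin.suc) t))
                    (cong (_+ dot y (combination cs (x ∘ Fin.suc))) (sym (ℤΣ.*-distribˡ-sum (x Fin.zero) (λ t → y t * column c t)))))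
        where distribute : ∀ y a e r → y * (a * e + r) ≡ a * (y * e) + y * r
              distribute = solve-∀

    -- If c is orthogonal mod p to the columns and c k ≢ 0, then coordinate k of a combination of the
    -- columns is determined mod p by the others; so x ↦ (combination x with coordinate k removed)
    -- would inject F_p^n into F_p^(n-1).
    module _ (cs : Vec Column n) (independent : Independent cs) (c : Vec (Fin p) n)
             (orthogonal : ∀ j → p∣ dot (coefficients c) (column (lookup cs j))) (k : Fin n) where

      private
        image : Vec (Fin p) n → Vec (Fin p) m
        image x = removeAt (reduce (combination cs (coefficients x))) k

        image-injective : ¬ p∣ coefficients c k → ∀ x x′ → image x ≡ image x′ → x ≡ x′
        image-injective ¬p∣ck x x′ eq = lookup-injective λ j →
          p∣embed-sub⇒≡ _ _ (subst p∣_ (trans (cong (difference j -_) (difference-reduce-≡ j)) (ℤ.+-identityʳ (difference j)))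
                                       (p∣-sub-reduce difference j))
          where
          δ : Fin n → ℤ
          δ t = combination cs (coefficients x) t - combination cs (coefficients x′) t
          p∣δ-off-k : ∀ t → t ≢ k → p∣ δ t
          p∣δ-off-k t t≢k = reduce-≡⇒p∣-sub (combination cs (coefficients x)) (combination cs (coefficients x′)) t
            (trans (sym (Vec.removeAt-punchOut (reduce (combination cs (coefficients x))) (t≢k ∘ sym)))
                   (trans (cong (λ v → lookup v (punchOut (t≢k ∘ sym))) eq) (Vec.removeAt-punchOut (reduce (combination cs (coefficients x′))) (t≢k ∘ sym))))
          p∣dot-δ : p∣ dot (coefficients c) δ
          p∣dot-δ = subst p∣_ (sym (dot-sub (coefficients c) (combination cs (coefficients x)) (combination cs (coefficients x′))))
            (∣m∣n⇒∣m-n (dot-combination cs (coefficients c) orthogonal (coefficients x))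
                       (dot-combination cs (coefficients c) orthogonal (coefficients x′)))
          p∣δ : ∀ t → p∣ δ t
          p∣δ t with t Fin.≟ k
          ... | yes refl = p∣-*-cancelˡ (coefficients c k) (δ k) ¬p∣ck
                             (p∣-sum-single (λ t → coefficients c t * δ t) k (λ t t≢k → ∣n⇒∣m*n (coefficients c t) (p∣δ-off-k t t≢k)) p∣dot-δ)
          ... | no t≢k   = p∣δ-off-k t t≢k
          difference : Fin n → ℤ
          difference j = coefficients x j - coefficients x′ j
          difference-reduce-≡ : ∀ j → coefficients (reduce difference) j ≡ 0ℤ
          difference-reduce-≡ j = cong ℤ.+_ (independent (reduce difference) (λ t →
            p∣-sub-cancelˡ (subst p∣_ (sym (combination-sub cs (coefficients x) (coefficients x′) t)) (p∣δ t))
                           (p∣-combination-reduce cs difference t)) j)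

      orthogonal⇒zero : toℕ (lookup c k) ≡ 0
      orthogonal⇒zero = decidable-stable (toℕ (lookup c k) ℕ.≟ 0) λ ck≢0 →
        ℕ.<⇒≱ (^-monoʳ-< p (nonTrivial⇒n>1 p) (ℕ.n<1+n m))
          (subst₂ ℕ._≤_ (length-allVectors {p} n) (length-allVectors {p} m)
            (length-≤-of-injection image (allVectors-unique n)
              (λ {x} {x′} _ _ → image-injective (ck≢0 ∘ p∣embed⇒zero _) x x′) (λ {x} _ → ∈-allVectors (image x))))
        where instance _ = prime⇒nonTrivial p-prime

module MatrixEncoding where

  open Counting using (indicator; sum-syntax; sum-cong-≗)
  open Weights
  open LinearAlgebraModP
  open SquareCase
  open import Data.Fin as Fin using (Fin; toℕ)
  open import Data.Integer as ℤ using (ℤ; +_; _+_; _*_)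
  import Data.Integer.Properties as ℤ
  open import Data.Integer.Divisibility.Signed using (∣ᵤ⇒∣)
  open import Data.Nat as ℕ using (ℕ; zero; suc; _≟_)
  import Data.Nat.Properties as ℕ
  open import Data.Nat.Primality using (Prime)
  open import Data.Vec as Vec using (Vec; []; _∷_; lookup; tabulate)
  import Data.Vec.Properties as Vec
  open import Function using (_∘_)
  open import Relation.Binary.PropositionalEquality using (_≡_; refl; sym; trans; cong; cong₂; subst)
  open import Relation.Nullary using (yes; no)
  open import Relation.Nullary.Decidable using (¬?)
  open import Relation.Unary using (Decidable)

  Vec-count-tabulate : ∀ {A : Set} {P : A → Set} (P? : Decidable P) {n} (g : Fin n → A) →
                   Vec.count P? (tabulate g) ≡ ∑[ i < n ] indicator (P? (g i))
  Vec-count-tabulate P? {zero}  g = refl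
  Vec-count-tabulate P? {suc n} g with P? (g Fin.zero)
  ... | yes _ = cong suc (Vec-count-tabulate P? (g ∘ Fin.suc))
  ... | no _  = Vec-count-tabulate P? (g ∘ Fin.suc)

  +sum-tabulate : ∀ {n} (g : Fin n → ℕ) → + Vec.sum (tabulate g) ≡ ℤΣ.sum (λ i → + g i)
  +sum-tabulate {zero}  g = refl
  +sum-tabulate {suc n} g = trans (ℤ.pos-+ (g Fin.zero) _) (cong (ℤ._+_ (+ g Fin.zero)) (+sum-tabulate (g ∘ Fin.suc)))

  module Matrices (p : ℕ) (p-prime : Prime p) (m : ℕ) where

    private
      n = suc m

    open SquareMatrices p p-prime m

    fromColumns : ∀ {r} → Vec Column r → Matrix n r p
    fromColumns cs = tabulate λ i → Vec.map (λ c → lookup c i) cs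

    entry-fromColumns : ∀ {r} (cs : Vec Column r) i j → entry (fromColumns cs) i j ≡ lookup (lookup cs j) i
    entry-fromColumns cs i j = trans (cong (λ row → lookup row j) (Vec.lookup∘tabulate (λ i → Vec.map (λ c → lookup c i) cs) i))
                                   (Vec.lookup-map j (λ c → lookup c i) cs)

    fromColumns-injective : ∀ {r} {cs cs′ : Vec Column r} → fromColumns cs ≡ fromColumns cs′ → cs ≡ cs′
    fromColumns-injective {cs = cs} {cs′} eq = lookup-injective λ j → lookup-injective λ i →
      trans (sym (entry-fromColumns cs i j)) (trans (cong (λ M → entry M i j) eq) (entry-fromColumns cs′ i j))

    colWeight-fromColumns : ∀ {r} (cs : Vec Column r) j → colWeight (fromColumns cs) j ≡ weight (lookup cs j)
    colWeight-fromColumns cs j = trans (Vec-count-tabulate (λ i → ¬? (toℕ (entry (fromColumns cs) i j) ≟ 0)) (λ i → i))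
      (trans (sum-cong-≗ λ i → cong (λ x → indicator (¬? (toℕ x ≟ 0))) (entry-fromColumns cs i j))
             (sym (weight≡∑nonzero (lookup cs j))))

    +sum≡combination : ∀ {r} (cs : Vec Column r) (c : Vec (Fin p) r) k →
      + Vec.sum (tabulate λ j → toℕ (lookup c j) ℕ.* toℕ (lookup (lookup cs j) k)) ≡ combination cs (coefficients c) k
    +sum≡combination []       []      k = refl
    +sum≡combination (col ∷ cs) (x ∷ c) k =
      trans (ℤ.pos-+ (toℕ x ℕ.* toℕ (lookup col k)) _)
            (cong₂ _+_ (ℤ.pos-* (toℕ x) (toℕ (lookup col k))) (+sum≡combination cs c k))

    colsIndep-fromColumns : ∀ {r} (cs : Vec Column r) → Independent cs → ColsIndep (fromColumns cs)
    colsIndep-fromColumns cs independent c p∣rows = independent c λ k →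
      subst p∣_ (trans (cong (λ v → + Vec.sum v) (Vec.tabulate-cong λ j → cong (λ x → toℕ (lookup c j) ℕ.* toℕ x) (entry-fromColumns cs k j)))
                       (+sum≡combination cs c k))
            (∣ᵤ⇒∣ (p∣rows k))

    rowsIndep-fromColumns : (cs : Vec Column n) → Independent cs → RowsIndep (fromColumns cs)
    rowsIndep-fromColumns cs independent c p∣columns = orthogonal⇒zero cs independent c λ j →
      subst p∣_ (trans (+sum-tabulate (λ i → toℕ (lookup c i) ℕ.* toℕ (entry (fromColumns cs) i j))) (ℤΣ.sum-cong-≗ λ i →
                   trans (ℤ.pos-* (toℕ (lookup c i)) _) (cong (λ x → + toℕ (lookup c i) * + toℕ x) (entry-fromColumns cs i j))))
            (∣ᵤ⇒∣ (p∣columns j))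

module RationalBound where

  open Counting
  open Weights
  open LinearAlgebraModP
  open ExtensionCounting using (factor)
  open ColumnTuples
  open SquareCase
  open MatrixEncoding
  open import Data.Integer as ℤ using (ℤ; +_; 0ℤ; _+_; _-_; _*_)
  import Data.Integer.Properties as ℤ
  open import Data.Integer.Tactic.RingSolver using (solve-∀)
  open import Data.List as List using (List; []; length)
  import Data.List.Properties as List
  open import Data.List.Membership.Propositional.Properties using (∈-map⁻)
  open import Data.List.Relation.Unary.All as All using (All; [])
  import Data.List.Relation.Unary.Unique.Propositional.Properties as Unique
  import Data.List.Relation.Unary.AllPairs as AllPairs
  open import Data.Nat as ℕ using (ℕ; zero; suc; _∸_; _^_; _≤_; _<_; _≤?_; s≤s)
  open import Data.Nat.Combinatorics using (_C_)
  import Data.Nat.Properties as ℕ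
  open import Data.Nat.Primality using (Prime)
  open import Data.Product using (_,_)
  open import Data.Sum using (inj₁; inj₂)
  open import Data.Rational.Unnormalised as ℚ using (ℚᵘ; mkℚᵘ; ↥_; ↧_; ↧ₙ_; *≤*)
  open import Data.Vec using (Vec)
  open import Relation.Binary.PropositionalEquality using (_≡_; refl; sym; trans; cong; cong₂; subst; subst₂; module ≡-Reasoning)
  open import Relation.Nullary using (yes; no)

  ↥-* : ∀ x y → ↥ (x ℚ.* y) ≡ ↥ x * ↥ y
  ↥-* (mkℚᵘ _ _) (mkℚᵘ _ _) = refl

  ↧ₙ-* : ∀ x y → ↧ₙ (x ℚ.* y) ≡ ↧ₙ x ℕ.* ↧ₙ y
  ↧ₙ-* (mkℚᵘ _ _) (mkℚᵘ _ _) = refl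

  module _ (m b s : ℕ) where

    private
      q = suc m
      p = suc (suc b)
      a = suc b

    -- bound q p (suc s) r _ unfolds to prodQ r rationalFactor.
    rationalFactor : ℕ → ℚᵘ
    rationalFactor i = (((+ (q C suc s)) ℚ./ q) ℚ.* ((+ ((p ∸ 1) ^ suc s) - + ((p ∸ 1) ^ (suc s ∸ 1))) ℚ./ 1)) ℚ.* ((+ q - + i) ℚ./ 1)

    private
      ↧ₙ-rationalFactor : ∀ i → ↧ₙ (rationalFactor i) ≡ q
      ↧ₙ-rationalFactor i = cong suc (trans (ℕ.*-identityʳ (m ℕ.* 1)) (ℕ.*-identityʳ m))

      a^[1+s]-a^s≡a^s*b : + (a ^ suc s) - + (a ^ s) ≡ + (a ^ s ℕ.* b)
      a^[1+s]-a^s≡a^s*b = trans (cong (_- + (a ^ s)) (ℤ.pos-+ (a ^ s) (b ℕ.* a ^ s)))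
                               (trans (x+y-x≡y (+ (a ^ s)) (+ (b ℕ.* a ^ s))) (cong +_ (ℕ.*-comm b (a ^ s))))
        where x+y-x≡y : ∀ x y → x + y - x ≡ y
              x+y-x≡y = solve-∀

    ↥-rationalFactor : ∀ i → i ≤ q → ↥ (rationalFactor i) ≡ + factor b m s i
    ↥-rationalFactor i i≤q = begin
      (+ (q C suc s) * (+ (a ^ suc s) - + (a ^ s))) * (+ q - + i) ≡⟨ cong (λ d → (+ (q C suc s) * d) * (+ q - + i)) a^[1+s]-a^s≡a^s*b ⟩
      (+ (q C suc s) * + (a ^ s ℕ.* b)) * (+ q - + i)             ≡⟨ cong ((+ (q C suc s) * + (a ^ s ℕ.* b)) *_) (trans (ℤ.m-n≡m⊖n q i) (ℤ.⊖-≥ i≤q)) ⟩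
      (+ (q C suc s) * + (a ^ s ℕ.* b)) * + (q ∸ i)               ≡⟨ cong (_* + (q ∸ i)) (sym (ℤ.pos-* (q C suc s) (a ^ s ℕ.* b))) ⟩
      + ((q C suc s) ℕ.* (a ^ s ℕ.* b)) * + (q ∸ i)               ≡⟨ sym (ℤ.pos-* ((q C suc s) ℕ.* (a ^ s ℕ.* b)) (q ∸ i)) ⟩
      + factor b m s i ∎
      where open ≡-Reasoning

    ↥-prodQ : ∀ r → r ≤ q → ↥ (prodQ r rationalFactor) ≡ + ∏ r (factor b m s)
    ↥-prodQ zero    _   = refl
    ↥-prodQ (suc r) r<q = trans (↥-* (prodQ r rationalFactor) (rationalFactor r))
      (trans (cong₂ _*_ (↥-prodQ r (ℕ.<⇒≤ r<q)) (↥-rationalFactor r (ℕ.<⇒≤ r<q))) (sym (ℤ.pos-* (∏ r (factor b m s)) (factor b m s r))))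

    ↧ₙ-prodQ : ∀ r → ↧ₙ (prodQ r rationalFactor) ≡ q ^ r
    ↧ₙ-prodQ zero    = refl
    ↧ₙ-prodQ (suc r) = trans (↧ₙ-* (prodQ r rationalFactor) (rationalFactor r))
      (trans (cong₂ ℕ._*_ (↧ₙ-prodQ r) (↧ₙ-rationalFactor r)) (ℕ.*-comm (q ^ r) q))

    ↥-prodQ-beyond : ∀ r → q < r → ↥ (prodQ r rationalFactor) ≡ 0ℤ
    ↥-prodQ-beyond (suc r) (s≤s q≤r) with ℕ.m≤n⇒m<n∨m≡n q≤r
    ... | inj₁ q<r = trans (↥-* (prodQ r rationalFactor) (rationalFactor r))
                           (trans (cong (_* ↥ (rationalFactor r)) (↥-prodQ-beyond r q<r)) (ℤ.*-zeroˡ (↥ (rationalFactor r))))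
    ... | inj₂ refl = trans (↥-* (prodQ r rationalFactor) (rationalFactor r))
                            (trans (cong (↥ (prodQ r rationalFactor) *_) (trans (↥-rationalFactor q ℕ.≤-refl) (cong +_ factor-q≡0)))
                                   (ℤ.*-zeroʳ (↥ (prodQ r rationalFactor))))
      where factor-q≡0 : factor b m s q ≡ 0
            factor-q≡0 = trans (cong ((q C suc s) ℕ.* (a ^ s ℕ.* b) ℕ.*_) (ℕ.n∸n≡0 q)) (ℕ.*-zeroʳ ((q C suc s) ℕ.* (a ^ s ℕ.* b)))

  module _ (b : ℕ) (p-prime : Prime (suc (suc b))) (m s : ℕ) where

    private
      p = suc (suc b)
      q = suc m

    open Columns p p-prime q using (Column; Independent)
    open Tuples b p-prime m s
    open Matrices p p-prime m

    admissible⇒InGL : ∀ {r} → r ≤ q → (cs : Vec Column r) → Admissible cs → InGL q r p (suc s) (fromColumns cs)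
    admissible⇒InGL r≤q cs (independent , weights) =
      ((λ _ → colsIndep-fromColumns cs independent) , (λ q≤r → rowsIndep (ℕ.≤-antisym r≤q q≤r) cs independent)) ,
      (λ j → trans (colWeight-fromColumns cs j) (weights j))
      where
      rowsIndep : ∀ {r} → r ≡ q → (cs : Vec Column r) → Independent cs → RowsIndep (fromColumns cs)
      rowsIndep refl = rowsIndep-fromColumns

    card-InGL : ∀ r → CardGE (InGL q r p (suc s)) (prodQ r (rationalFactor m b s))
    card-InGL r with r ≤? q
    ... | yes r≤q = List.map fromColumns (tuples r) ,
                    Unique.map⁺ fromColumns-injective (tuples-unique r) ,
                    All.tabulate (λ M∈ → let (cs , cs∈ , M≡) = ∈-map⁻ fromColumns M∈
                                         in subst (InGL q r p (suc s)) (sym M≡) (admissible⇒InGL r≤q cs (tuples-admissible r cs∈))) ,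
                    *≤* (subst₂ ℤ._≤_ (sym (trans (ℤ.*-identityʳ _) (↥-prodQ m b s r r≤q)))
                                      (sym (trans (cong (λ d → + n * + d) (↧ₙ-prodQ m b s r)) (sym (ℤ.pos-* n (q ^ r)))))
                                      (ℤ.+≤+ (subst (∏ r (factor b m s) ≤_) (trans (ℕ.*-comm (q ^ r) _) (cong (ℕ._* q ^ r) (sym (List.length-map fromColumns (tuples r)))))
                                                    (tuples-bound r))))
      where n = length (List.map fromColumns (tuples r))
    ... | no r≰q  = [] , AllPairs.[] , All.[] ,
                    *≤* (subst₂ ℤ._≤_ (sym (trans (ℤ.*-identityʳ _) (↥-prodQ-beyond m b s r (ℕ.≰⇒> r≰q))))
                                      (sym (ℤ.*-zeroˡ (↧ (prodQ r (rationalFactor m b s)))))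
                                      ℤ.≤-refl)

open RationalBound using (card-InGL)

theorem4 : (q p : ℕ) (qp : Prime q) → Prime p →
           Σ ℕ (λ g → PrimitiveRoot q g × CongMod q p g) →
           (s : ℕ) → 1 ≤ s → s ≤ q ∸ 1 →
           (r : ℕ) → 1 ≤ r →
           CardGE (InGL q r p s) (bound q p s r qp)
theorem4 zero    _             q-prime _       _ _       _ _ _ _ = ⊥-elim (¬prime[0] q-prime)
theorem4 (suc m) zero          _       p-prime _ _       _ _ _ _ = ⊥-elim (¬prime[0] p-prime)
theorem4 (suc m) (suc zero)    _       p-prime _ _       _ _ _ _ = ⊥-elim (¬prime[1] p-prime)
theorem4 (suc m) (suc (suc b)) _       p-prime _ (suc s) _ _ r _ = card-InGL b p-prime m s r
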